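{- Let $H$ be a hypergraph in which every pair of distinct hyperedges intersects in at most $\overline{\lambda}$ vertices. For a positive integer $t$, let $\overline{D}_t$ be the minimum, over all choices of $t$ distinct hyperedges of $H$, of the sum of their cardinalities. Then for every integer $t$ with $1\le t\le m(H)$, $$b_L(H)\ge \overline{D}_t-\overline{\lambda}\binom{t}{2}-t.$$
   Context: A hypergraph $H$ consists of a finite vertex set $V(H)$ and a finite collection $E(H)$ of subsets of $V(H)$. Lazy burning: a set $B\subseteq V(H)$ is burned initially; in each subsequent round every unburned vertex $v$ for which some hyperedge $h\ni v$ has $h\setminus\{v\}$ entirely burned becomes burned. $B$ is a lazy burning set if eventually all vertices burn; $b_L(H)$ is the minimum size of a lazy burning set. The incidence graph $\mathrm{IG}(H)$ is the bipartite graph on $V(H)\cup E(H)$ with $v\sim h$ iff $v\in h$. A $C$-matching is a list $(v_1h_1,\dots,v_kh_k)$ of edges of $\mathrm{IG}(H)$ with $v_i\in h_i$ and $h_i\cap\{v_{i+1},\dots,v_k\}=\emptyset$ for all $i$; $m(H)$ is the maximum length of a $C$-matching. -}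

module Defs where

open import Data.Nat using (ℕ; zero; suc; _+_; _≤_)
open import Data.Fin using (Fin)
open import Data.Fin.Subset using (Subset; _∈_; _∉_; ∣_∣)
open import Data.Product using (Σ; ∃; _×_)
open import Data.Sum using (_⊎_)
open import Data.List using (List; map; allFin)
open import Data.Nat.ListAction using (sum)
open import Function.Definitions using (Injective)
open import Relation.Binary.PropositionalEquality using (_≡_)
open import Relation.Nullary using (¬_)

-- A (simple) hypergraph: vertex set Fin n, a finite *set* of hyperedges,
-- given as an injective family of subsets indexed by Fin m.
record Hypergraph : Set where
  field
    n     : ℕ
    m     : ℕ
    edge  : Fin m → Subset n
    edge-inj : Injective _≡_ _≡_ edge
open Hypergraph public

module _ (H : Hypergraph) where

  burnedAt : Subset (n H) → ℕ → Fin (n H) → Set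
  burnedAt B zero    v = v ∈ B
  burnedAt B (suc r) v =
    burnedAt B r v ⊎
    (Σ (Fin (m H)) λ e → (v ∈ edge H e) ×
       (∀ u → u ∈ edge H e → ¬ (u ≡ v) → burnedAt B r u))

  IsLazyBurningSet : Subset (n H) → Set
  IsLazyBurningSet B = ∃ λ r → ∀ v → burnedAt B r v

  IsLazyBurningNumber : ℕ → Set
  IsLazyBurningNumber b =
    (Σ (Subset (n H)) λ B → IsLazyBurningSet B × ∣ B ∣ ≡ b) ×
    (∀ B → IsLazyBurningSet B → b ≤ ∣ B ∣)

  IsCMatching : (k : ℕ) → (Fin k → Fin (n H)) → (Fin k → Fin (m H)) → Set
  IsCMatching k v h =
    (∀ i → v i ∈ edge H (h i)) ×
    (∀ i j → Data.Fin._<_ i j → v j ∉ edge H (h i))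

  -- k = m(H), the maximum length of a C-matching
  IsMaxCMatchingSize : ℕ → Set
  IsMaxCMatchingSize k =
    (Σ (Fin k → Fin (n H)) λ v → Σ (Fin k → Fin (m H)) λ h → IsCMatching k v h) ×
    (∀ k' (v : Fin k' → Fin (n H)) (h : Fin k' → Fin (m H)) →
       IsCMatching k' v h → k' ≤ k)

  edgeSum : (t : ℕ) → (Fin t → Fin (m H)) → ℕ
  edgeSum t f = sum (map (λ i → ∣ edge H (f i) ∣) (allFin t))

  IsMinEdgeSum : ℕ → ℕ → Set
  IsMinEdgeSum t d =
    (Σ (Fin t → Fin (m H)) λ f → Injective _≡_ _≡_ f × edgeSum t f ≡ d) ×
    (∀ (f : Fin t → Fin (m H)) → Injective _≡_ _≡_ f → d ≤ edgeSum t f)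

{-# OPTIONS --safe #-}
-- A C-matching (v₁h₁, …, v_kh_k) lets the complement of {v₁, …, v_k} burn,
-- hᵢ igniting vᵢ in round i, so b_L(H) ≤ n − m(H).  Hence for t ≤ m(H) a
-- minimum lazy burning set B misses at least t vertices.  Some vertex v ∉ B
-- burns in the first round through a hyperedge e ⊆ B ∪ {v}; adding v to B and
-- repeating t times yields t hyperedges, distinct because each lies in the
-- enlarged set and none of the later ones does, whose union lies in a set of
-- size |B| + t.  Their sizes sum to at least D̄_t and, by inclusion–exclusion,
-- to at most the size of their union plus λ̄ for each of the C(t,2) pairs.
module Submission where

open import Defs
open import Data.Nat using (ℕ; _≤_; _*_; _∸_)
open import Data.Nat.Combinatorics using (_C_)
open import Data.Fin using (Fin)
open import Data.Fin.Subset using (_∩_; ∣_∣)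
open import Relation.Binary.PropositionalEquality using (_≡_)
open import Relation.Nullary using (¬_)

open import Data.Nat using (zero; suc; _+_; _<_; z≤n; s≤s; z<s; s<s)
open import Data.Nat.Properties hiding (_≟_)
open import Data.Nat.Combinatorics using (nC1≡n; nCk+nC[k+1]≡[n+1]C[k+1])
open import Data.Nat.ListAction using (sum)
open import Data.Fin using (zero; suc; _≟_)
open import Data.Fin.Properties using (any?; ¬∀⟶∃¬)
open import Data.Fin.Subset using (Subset; _∈_; _∉_; _∪_; _⊆_; _-_; ⊤; ⊥; ⁅_⁆; ⋃; inside; outside)
open import Data.Fin.Subset.Properties
  using (_∈?_; ∈⊤; ∣⊤∣≡n; ∣⊥∣≡0; ∣⁅x⁆∣≡1; x∈⁅x⁆; p⊆q⇒∣p∣≤∣q∣; ⊆-trans; p⊆p∪q; q⊆p∪q;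
         x∈p∪q⁻; x∈p∪q⁺; ∣p∩q∣≤∣q∣; ∪-identityˡ; ∩-distribˡ-∪; x∈p∧x≢y⇒x∈p-y; x∈p⇒∣p-x∣<∣p∣)
open import Data.List using (List; _∷_; length; map; tabulate)
open import Data.List.Properties using (map-tabulate; length-tabulate)
open import Data.List.Relation.Unary.All using (All; []; _∷_)
open import Data.List.Relation.Unary.AllPairs using (AllPairs; []; _∷_)
import Data.List.Relation.Unary.AllPairs.Properties as AllPairs
open import Data.Vec using ([]; _∷_)
open import Data.Product using (∃; ∃₂; _×_; _,_)
open import Data.Sum using (inj₁; inj₂; [_,_]′)
open import Function using (_∘_)
open import Function.Definitions using (Injective)
open import Relation.Binary.PropositionalEquality using (refl; sym; trans; cong; subst; _≢_; module ≡-Reasoning)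
open import Relation.Nullary using (yes; no; ¬?; _×-dec_; contradiction)
open import Relation.Nullary.Decidable using (decidable-stable)

∣p∪q∣+∣p∩q∣≡∣p∣+∣q∣ : ∀ {n} (p q : Subset n) → ∣ p ∪ q ∣ + ∣ p ∩ q ∣ ≡ ∣ p ∣ + ∣ q ∣
∣p∪q∣+∣p∩q∣≡∣p∣+∣q∣ []            []            = refl
∣p∪q∣+∣p∩q∣≡∣p∣+∣q∣ (outside ∷ p) (outside ∷ q) = ∣p∪q∣+∣p∩q∣≡∣p∣+∣q∣ p q
∣p∪q∣+∣p∩q∣≡∣p∣+∣q∣ (inside  ∷ p) (outside ∷ q) = cong suc (∣p∪q∣+∣p∩q∣≡∣p∣+∣q∣ p q)
∣p∪q∣+∣p∩q∣≡∣p∣+∣q∣ (outside ∷ p) (inside  ∷ q) =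
  trans (cong suc (∣p∪q∣+∣p∩q∣≡∣p∣+∣q∣ p q)) (sym (+-suc ∣ p ∣ ∣ q ∣))
∣p∪q∣+∣p∩q∣≡∣p∣+∣q∣ (inside  ∷ p) (inside  ∷ q) = cong suc (begin
  ∣ p ∪ q ∣ + suc ∣ p ∩ q ∣  ≡⟨ +-suc ∣ p ∪ q ∣ ∣ p ∩ q ∣ ⟩
  suc (∣ p ∪ q ∣ + ∣ p ∩ q ∣) ≡⟨ cong suc (∣p∪q∣+∣p∩q∣≡∣p∣+∣q∣ p q) ⟩
  suc (∣ p ∣ + ∣ q ∣)         ≡⟨ +-suc ∣ p ∣ ∣ q ∣ ⟨
  ∣ p ∣ + suc ∣ q ∣           ∎)
  where open ≡-Reasoning

∣p∪q∣≤∣p∣+∣q∣ : ∀ {n} (p q : Subset n) → ∣ p ∪ q ∣ ≤ ∣ p ∣ + ∣ q ∣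
∣p∪q∣≤∣p∣+∣q∣ p q = ≤-trans (m≤m+n ∣ p ∪ q ∣ ∣ p ∩ q ∣) (≤-reflexive (∣p∪q∣+∣p∩q∣≡∣p∣+∣q∣ p q))

∣⁅x⁆∪p∣≤1+∣p∣ : ∀ {n} (x : Fin n) (p : Subset n) → ∣ ⁅ x ⁆ ∪ p ∣ ≤ suc ∣ p ∣
∣⁅x⁆∪p∣≤1+∣p∣ x p = ≤-trans (∣p∪q∣≤∣p∣+∣q∣ ⁅ x ⁆ p) (≤-reflexive (cong (_+ ∣ p ∣) (∣⁅x⁆∣≡1 x)))

∣p∩q∪r∣≤∣p∩q∣+∣p∩r∣ : ∀ {n} (p q r : Subset n) → ∣ p ∩ (q ∪ r) ∣ ≤ ∣ p ∩ q ∣ + ∣ p ∩ r ∣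
∣p∩q∪r∣≤∣p∩q∣+∣p∩r∣ p q r =
  subst (λ s → ∣ s ∣ ≤ ∣ p ∩ q ∣ + ∣ p ∩ r ∣) (sym (∩-distribˡ-∪ p q r)) (∣p∪q∣≤∣p∣+∣q∣ (p ∩ q) (p ∩ r))

∪-lub : ∀ {n} {p q r : Subset n} → p ⊆ r → q ⊆ r → p ∪ q ⊆ r
∪-lub {p = p} {q} p⊆r q⊆r x∈p∪q = [ p⊆r , q⊆r ]′ (x∈p∪q⁻ p q x∈p∪q)

∣p∣<n⇒∃∉p : ∀ {n} {p : Subset n} → ∣ p ∣ < n → ∃ λ x → x ∉ p
∣p∣<n⇒∃∉p {n} {p} ∣p∣<n = ¬∀⟶∃¬ n (_∈ p) (_∈? p) λ all∈p →
  <⇒≱ ∣p∣<n (subst (_≤ ∣ p ∣) (∣⊤∣≡n n) (p⊆q⇒∣p∣≤∣q∣ {p = ⊤} (λ {x} _ → all∈p x)))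

[1+n]C2≡n+nC2 : ∀ n → suc n C 2 ≡ n + n C 2
[1+n]C2≡n+nC2 n = trans (sym (nCk+nC[k+1]≡[n+1]C[k+1] n 1)) (cong (_+ n C 2) (nC1≡n n))

module _ {n : ℕ} (λ̄ : ℕ) where

  ∣p∩⋃qs∣≤λ̄*len : ∀ (p : Subset n) {qs} → All (λ q → ∣ p ∩ q ∣ ≤ λ̄) qs →
                   ∣ p ∩ ⋃ qs ∣ ≤ λ̄ * length qs
  ∣p∩⋃qs∣≤λ̄*len p [] =
    ≤-trans (∣p∩q∣≤∣q∣ p ⊥) (≤-reflexive (trans (∣⊥∣≡0 n) (sym (*-zeroʳ λ̄))))
  ∣p∩⋃qs∣≤λ̄*len p {q ∷ qs} (∣p∩q∣≤λ̄ ∷ rest) = begin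
    ∣ p ∩ (q ∪ ⋃ qs) ∣            ≤⟨ ∣p∩q∪r∣≤∣p∩q∣+∣p∩r∣ p q (⋃ qs) ⟩
    ∣ p ∩ q ∣ + ∣ p ∩ ⋃ qs ∣      ≤⟨ +-mono-≤ ∣p∩q∣≤λ̄ (∣p∩⋃qs∣≤λ̄*len p rest) ⟩
    λ̄ + λ̄ * length qs             ≡⟨ *-suc λ̄ (length qs) ⟨
    λ̄ * suc (length qs)           ∎
    where open ≤-Reasoning

  sum-∣p∣≤∣⋃p∣+λ̄*lenC2 : ∀ {ps : List (Subset n)} → AllPairs (λ p q → ∣ p ∩ q ∣ ≤ λ̄) ps →
                         sum (map ∣_∣ ps) ≤ ∣ ⋃ ps ∣ + λ̄ * (length ps C 2)
  sum-∣p∣≤∣⋃p∣+λ̄*lenC2 [] = z≤n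
  sum-∣p∣≤∣⋃p∣+λ̄*lenC2 {p ∷ qs} (p∩qs≤λ̄ ∷ qs-pairs) = begin
    ∣ p ∣ + sum (map ∣_∣ qs)                    ≤⟨ +-monoʳ-≤ ∣ p ∣ (sum-∣p∣≤∣⋃p∣+λ̄*lenC2 qs-pairs) ⟩
    ∣ p ∣ + (∣ U ∣ + λ̄ * (k C 2))               ≡⟨ +-assoc ∣ p ∣ ∣ U ∣ _ ⟨
    (∣ p ∣ + ∣ U ∣) + λ̄ * (k C 2)               ≡⟨ cong (_+ λ̄ * (k C 2)) (∣p∪q∣+∣p∩q∣≡∣p∣+∣q∣ p U) ⟨
    (∣ p ∪ U ∣ + ∣ p ∩ U ∣) + λ̄ * (k C 2)       ≤⟨ +-monoˡ-≤ (λ̄ * (k C 2))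
                                                     (+-monoʳ-≤ ∣ p ∪ U ∣ (∣p∩⋃qs∣≤λ̄*len p p∩qs≤λ̄)) ⟩
    (∣ p ∪ U ∣ + λ̄ * k) + λ̄ * (k C 2)           ≡⟨ +-assoc ∣ p ∪ U ∣ _ _ ⟩
    ∣ p ∪ U ∣ + (λ̄ * k + λ̄ * (k C 2))           ≡⟨ cong (∣ p ∪ U ∣ +_) (*-distribˡ-+ λ̄ k (k C 2)) ⟨
    ∣ p ∪ U ∣ + λ̄ * (k + k C 2)                 ≡⟨ cong (λ c → ∣ p ∪ U ∣ + λ̄ * c) ([1+n]C2≡n+nC2 k) ⟨
    ∣ p ∪ U ∣ + λ̄ * (suc k C 2)                 ∎
    where
    open ≤-Reasoning
    U = ⋃ qs
    k = length qs

module _ (H : Hypergraph) where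

  burnedAt-trans : ∀ {B B′} r₀ → (∀ {w} → w ∈ B′ → burnedAt H B r₀ w) →
                   ∀ r {w} → burnedAt H B′ r w → burnedAt H B (r + r₀) w
  burnedAt-trans r₀ B′-burned zero w∈B′ = B′-burned w∈B′
  burnedAt-trans r₀ B′-burned (suc r) (inj₁ burned) = inj₁ (burnedAt-trans r₀ B′-burned r burned)
  burnedAt-trans r₀ B′-burned (suc r) (inj₂ (e , w∈e , rest-burned)) =
    inj₂ (e , w∈e , λ u u∈e u≢w → burnedAt-trans r₀ B′-burned r (rest-burned u u∈e u≢w))

  isLazyBurningSet-trans : ∀ {B B′} r₀ → (∀ {w} → w ∈ B′ → burnedAt H B r₀ w) →
                           IsLazyBurningSet H B′ → IsLazyBurningSet H B
  isLazyBurningSet-trans r₀ B′-burned (r , all-burned) =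
    r + r₀ , λ w → burnedAt-trans r₀ B′-burned r (all-burned w)

  earliest-ignition : ∀ {B} r {w} → burnedAt H B r w → w ∉ B →
    ∃₂ λ v e → v ∉ B × v ∈ edge H e × (∀ u → u ∈ edge H e → u ≢ v → u ∈ B)
  earliest-ignition zero w∈B w∉B = contradiction w∈B w∉B
  earliest-ignition (suc r) (inj₁ burned) w∉B = earliest-ignition r burned w∉B
  earliest-ignition {B} (suc r) {w} (inj₂ (e , w∈e , rest-burned)) w∉B
    with any? (λ u → u ∈? edge H e ×-dec ¬? (u ≟ w) ×-dec ¬? (u ∈? B))
  ... | yes (u , u∈e , u≢w , u∉B) = earliest-ignition r (rest-burned u u∈e u≢w) u∉B
  ... | no ∄u = w , e , w∉B , w∈e , λ u u∈e u≢w →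
    decidable-stable (u ∈? B) (λ u∉B → ∄u (u , u∈e , u≢w , u∉B))

  cMatching-tail : ∀ {k v h} → IsCMatching H (suc k) v h → IsCMatching H k (v ∘ suc) (h ∘ suc)
  cMatching-tail (v∈h , v∉h) = v∈h ∘ suc , λ i j i<j → v∉h (suc i) (suc j) (s<s i<j)

  cMatching-complement-burns : ∀ k {v h} → IsCMatching H k v h →
    ∃ λ B → IsLazyBurningSet H B × ∣ B ∣ + k ≤ n H × (∀ w → w ∉ B → ∃ λ i → w ≡ v i)
  cMatching-complement-burns zero _ =
    ⊤ , (0 , λ _ → ∈⊤) , ≤-reflexive (trans (+-identityʳ _) (∣⊤∣≡n (n H))) ,
    λ _ w∉⊤ → contradiction ∈⊤ w∉⊤
  cMatching-complement-burns (suc k) {v} {h} cm@(v∈h , v∉h)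
    with cMatching-complement-burns k (cMatching-tail cm)
  ... | B′ , B′-burns , ∣B′∣+k≤n , outside-B′ =
    B′ - v zero , isLazyBurningSet-trans 1 B′-burned B′-burns , size , outside-B
    where
    h₀⊆B′ : edge H (h zero) ⊆ B′
    h₀⊆B′ {u} u∈h₀ with u ∈? B′
    ... | yes u∈B′ = u∈B′
    ... | no u∉B′ with outside-B′ u u∉B′
    ...   | i , refl = contradiction u∈h₀ (v∉h zero (suc i) z<s)

    B′-burned : ∀ {w} → w ∈ B′ → burnedAt H (B′ - v zero) 1 w
    B′-burned {w} w∈B′ with w ≟ v zero
    ... | yes refl = inj₂ (h zero , v∈h zero , λ u u∈h₀ u≢v₀ → x∈p∧x≢y⇒x∈p-y (h₀⊆B′ u∈h₀) u≢v₀)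
    ... | no w≢v₀ = inj₁ (x∈p∧x≢y⇒x∈p-y w∈B′ w≢v₀)

    size : ∣ B′ - v zero ∣ + suc k ≤ n H
    size = ≤-trans (≤-reflexive (+-suc _ k))
                   (≤-trans (+-monoˡ-≤ k (x∈p⇒∣p-x∣<∣p∣ (h₀⊆B′ (v∈h zero)))) ∣B′∣+k≤n)

    outside-B : ∀ w → w ∉ B′ - v zero → ∃ λ i → w ≡ v i
    outside-B w w∉B with w ≟ v zero
    ... | yes w≡v₀ = zero , w≡v₀
    ... | no w≢v₀ with w ∈? B′
    ...   | yes w∈B′ = contradiction (x∈p∧x≢y⇒x∈p-y w∈B′ w≢v₀) w∉B
    ...   | no w∉B′ with outside-B′ w w∉B′
    ...     | i , w≡vᵢ = suc i , w≡vᵢ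

  lazyBurningNumber+cMatchingLength≤n : ∀ {b k v h} → IsLazyBurningNumber H b →
                                        IsCMatching H k v h → b + k ≤ n H
  lazyBurningNumber+cMatchingLength≤n {k = k} (_ , b-minimal) cm
    with cMatching-complement-burns k cm
  ... | B , B-burns , ∣B∣+k≤n , _ = ≤-trans (+-monoˡ-≤ k (b-minimal B B-burns)) ∣B∣+k≤n

  BurningEdges : ℕ → Subset (n H) → Set
  BurningEdges t B = ∃ λ (f : Fin t → Fin (m H)) → Injective _≡_ _≡_ f ×
    (∀ i → ¬ edge H (f i) ⊆ B) × ∣ ⋃ (tabulate (edge H ∘ f)) ∪ B ∣ ≤ t + ∣ B ∣

  burningEdges-cons : ∀ {t B v e} → v ∉ B → v ∈ edge H e → (∀ u → u ∈ edge H e → u ≢ v → u ∈ B) →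
                      BurningEdges t (⁅ v ⁆ ∪ B) → BurningEdges (suc t) B
  burningEdges-cons {t} {B} {v} {e} v∉B v∈e e-v⊆B (f′ , f′-inj , f′⊈B₁ , ∣U′∪B₁∣≤) =
    f , f-inj , f⊈B , size
    where
    B₁ = ⁅ v ⁆ ∪ B
    U′ = ⋃ (tabulate (edge H ∘ f′))

    e⊆B₁ : edge H e ⊆ B₁
    e⊆B₁ {u} u∈e with u ≟ v
    ... | yes refl = x∈p∪q⁺ (inj₁ (x∈⁅x⁆ v))
    ... | no u≢v = x∈p∪q⁺ (inj₂ (e-v⊆B u u∈e u≢v))

    B⊆B₁ : B ⊆ B₁
    B⊆B₁ = q⊆p∪q ⁅ v ⁆ B

    f : Fin (suc t) → Fin (m H)
    f zero = e
    f (suc i) = f′ i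

    e≢f′ : ∀ i → e ≢ f′ i
    e≢f′ i refl = f′⊈B₁ i e⊆B₁

    f-inj : Injective _≡_ _≡_ f
    f-inj {zero}  {zero}  _  = refl
    f-inj {zero}  {suc j} eq = contradiction eq (e≢f′ j)
    f-inj {suc i} {zero}  eq = contradiction (sym eq) (e≢f′ i)
    f-inj {suc i} {suc j} eq = cong suc (f′-inj eq)

    f⊈B : ∀ i → ¬ edge H (f i) ⊆ B
    f⊈B zero    e⊆B   = v∉B (e⊆B v∈e)
    f⊈B (suc i) f′ᵢ⊆B = f′⊈B₁ i (⊆-trans f′ᵢ⊆B B⊆B₁)

    size : ∣ (edge H e ∪ U′) ∪ B ∣ ≤ suc t + ∣ B ∣
    size = begin
      ∣ (edge H e ∪ U′) ∪ B ∣ ≤⟨ p⊆q⇒∣p∣≤∣q∣ (∪-lub (∪-lub (⊆-trans e⊆B₁ (q⊆p∪q U′ B₁)) (p⊆p∪q B₁))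
                                                   (⊆-trans B⊆B₁ (q⊆p∪q U′ B₁))) ⟩
      ∣ U′ ∪ B₁ ∣             ≤⟨ ∣U′∪B₁∣≤ ⟩
      t + ∣ B₁ ∣              ≤⟨ +-monoʳ-≤ t (∣⁅x⁆∪p∣≤1+∣p∣ v B) ⟩
      t + suc ∣ B ∣           ≡⟨ +-suc t ∣ B ∣ ⟩
      suc t + ∣ B ∣           ∎
      where open ≤-Reasoning

  lazyBurningSet⇒burningEdges : ∀ t {B} → IsLazyBurningSet H B → t + ∣ B ∣ ≤ n H → BurningEdges t B
  lazyBurningSet⇒burningEdges zero {B} _ _ =
    (λ ()) , (λ { {()} }) , (λ ()) , ≤-reflexive (cong ∣_∣ (∪-identityˡ B))
  lazyBurningSet⇒burningEdges (suc t) {B} B-burns@(r , all-burned) 1+t+∣B∣≤n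
    with ∣p∣<n⇒∃∉p (≤-trans (s≤s (m≤n+m ∣ B ∣ t)) 1+t+∣B∣≤n)
  ... | w , w∉B with earliest-ignition r (all-burned w) w∉B
  ... | v , e , v∉B , v∈e , e-v⊆B =
    burningEdges-cons v∉B v∈e e-v⊆B
      (lazyBurningSet⇒burningEdges t (isLazyBurningSet-trans 0 (q⊆p∪q ⁅ v ⁆ B) B-burns)
        (≤-trans (+-monoʳ-≤ t (∣⁅x⁆∪p∣≤1+∣p∣ v B)) (≤-trans (≤-reflexive (+-suc t ∣ B ∣)) 1+t+∣B∣≤n)))

module _ (H : Hypergraph) {λ̄ : ℕ}
         (λ̄-bound : ∀ (e f : Fin (m H)) → ¬ (e ≡ f) → ∣ edge H e ∩ edge H f ∣ ≤ λ̄) where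

  edgeSum≤∣⋃∣+λ̄*tC2 : ∀ t {f : Fin t → Fin (m H)} → Injective _≡_ _≡_ f →
                       edgeSum H t f ≤ ∣ ⋃ (tabulate (edge H ∘ f)) ∣ + λ̄ * (t C 2)
  edgeSum≤∣⋃∣+λ̄*tC2 t {f} f-inj = begin
    edgeSum H t f                       ≡⟨ cong sum (map-tabulate (λ i → i) (∣_∣ ∘ edge H ∘ f)) ⟩
    sum (tabulate (∣_∣ ∘ edge H ∘ f))   ≡⟨ cong sum (map-tabulate (edge H ∘ f) ∣_∣) ⟨
    sum (map ∣_∣ es)                    ≤⟨ sum-∣p∣≤∣⋃p∣+λ̄*lenC2 λ̄ (AllPairs.tabulate⁺ (λ {i} {j} i≢j → λ̄-bound (f i) (f j) (i≢j ∘ f-inj))) ⟩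
    ∣ ⋃ es ∣ + λ̄ * (length es C 2)      ≡⟨ cong (λ k → ∣ ⋃ es ∣ + λ̄ * (k C 2)) (length-tabulate (edge H ∘ f)) ⟩
    ∣ ⋃ es ∣ + λ̄ * (t C 2)              ∎
    where
    open ≤-Reasoning
    es = tabulate (edge H ∘ f)

  minEdgeSum≤λ̄*tC2+t+∣B∣ : ∀ {t D B} → IsMinEdgeSum H t D → BurningEdges H t B →
                            D ≤ λ̄ * (t C 2) + (t + ∣ B ∣)
  minEdgeSum≤λ̄*tC2+t+∣B∣ {t} {D} {B} (_ , D-minimal) (f , f-inj , _ , ∣⋃∪B∣≤t+∣B∣) = begin
    D                                     ≤⟨ D-minimal f f-inj ⟩
    edgeSum H t f                         ≤⟨ edgeSum≤∣⋃∣+λ̄*tC2 t f-inj ⟩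
    ∣ ⋃ es ∣ + λ̄ * (t C 2)                ≤⟨ +-monoˡ-≤ _ (p⊆q⇒∣p∣≤∣q∣ (p⊆p∪q {p = ⋃ es} B)) ⟩
    ∣ ⋃ es ∪ B ∣ + λ̄ * (t C 2)            ≤⟨ +-monoˡ-≤ _ ∣⋃∪B∣≤t+∣B∣ ⟩
    (t + ∣ B ∣) + λ̄ * (t C 2)             ≡⟨ +-comm (t + ∣ B ∣) _ ⟩
    λ̄ * (t C 2) + (t + ∣ B ∣)             ∎
    where
    open ≤-Reasoning
    es = tabulate (edge H ∘ f)

theorem2p7 : (H : Hypergraph) (λ̄ : ℕ) →
    (∀ (e f : Fin (m H)) → ¬ (e ≡ f) → ∣ edge H e ∩ edge H f ∣ ≤ λ̄) →
    (bL mH t Dt : ℕ) →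
    IsLazyBurningNumber H bL → IsMaxCMatchingSize H mH → IsMinEdgeSum H t Dt →
    1 ≤ t → t ≤ mH →
    Dt ∸ λ̄ * (t C 2) ∸ t ≤ bL
theorem2p7 H λ̄ λ̄-bound bL mH t Dt bL-minimum@((B , B-burns , refl) , _) ((_ , _ , cm) , _) Dt-minimum _ t≤mH =
  m≤n+o⇒m∸n≤o (Dt ∸ λ̄ * (t C 2)) t (m≤n+o⇒m∸n≤o Dt (λ̄ * (t C 2))
    (minEdgeSum≤λ̄*tC2+t+∣B∣ H λ̄-bound Dt-minimum (lazyBurningSet⇒burningEdges H t B-burns t+∣B∣≤n)))
  where
  t+∣B∣≤n : t + ∣ B ∣ ≤ n H
  t+∣B∣≤n = ≤-trans (+-monoˡ-≤ ∣ B ∣ t≤mH)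
                    (≤-trans (≤-reflexive (+-comm mH ∣ B ∣)) (lazyBurningNumber+cMatchingLength≤n H bL-minimum cm))
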